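{- Let $G$ be a modular graph with at least three vertices. Then $$SWW_3(G) = \frac{|V(G)|-2}{4}W(G) + \frac{|V(G)|-2}{8}\overline{WW}(G) + \frac18\widehat{WW}(G).$$
   Context: All graphs are finite, simple and connected; $d(u,v)$ is the shortest-path distance. A median of vertices $u,v,w$ is a vertex lying on a shortest $u,v$-path, a shortest $u,w$-path and a shortest $v,w$-path; $G$ is modular if every triple of vertices has at least one median. For nonempty $S\subseteq V(G)$, the Steiner distance $d(S)$ is the minimum number of edges of a connected subgraph whose vertex set contains $S$. $SWW_3(G)=\frac12\sum_{S\subseteq V(G),|S|=3}d(S)+\frac12\sum_{S\subseteq V(G),|S|=3}d(S)^2$. $W(G)=\sum_{\{u,v\}\subseteq V(G)}d(u,v)$ and $\overline{WW}(G)=\sum_{\{u,v\}\subseteq V(G)}d(u,v)^2$ (sums over unordered pairs of distinct vertices). $O_3(G)$ is the set of ordered triples $(u,v,w)$ of pairwise distinct vertices, and $\widehat{WW}(G)=\sum_{(u,v,w)\in O_3(G)} d(u,v)d(u,w)$. -}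

module Defs where

open import Data.Nat using (ℕ; zero; suc; _+_; _*_; _≤_; _<ᵇ_)
open import Data.Bool using (Bool; true; false; if_then_else_; not; _∧_)
open import Data.Fin using (Fin; toℕ; _≟_)
open import Data.Product using (Σ; ∃; _×_; _,_)
open import Relation.Nullary using (¬_; does)
open import Relation.Binary.PropositionalEquality using (_≡_)

∑ : ∀ {n} → (Fin n → ℕ) → ℕ
∑ {zero}  f = 0
∑ {suc n} f = f Fin.zero + ∑ (λ i → f (Fin.suc i))

[_]⇒_ : Bool → ℕ → ℕ
[ b ]⇒ x = if b then x else 0

_≺_ : ∀ {n} → Fin n → Fin n → Bool
i ≺ j = toℕ i <ᵇ toℕ j

_≢ᵇ_ : ∀ {n} → Fin n → Fin n → Bool
i ≢ᵇ j = not (does (i ≟ j))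

record Graph (n : ℕ) : Set where
  field
    adj     : Fin n → Fin n → Bool
    adj-sym : ∀ i j → adj i j ≡ adj j i
    irrefl  : ∀ i → adj i i ≡ false
open Graph public

data Walk {n : ℕ} (E : Fin n → Fin n → Bool) : Fin n → Fin n → ℕ → Set where
  here : ∀ {u} → Walk E u u 0
  step : ∀ {u v w k} → E u v ≡ true → Walk E v w k → Walk E u w (suc k)

Connected : ∀ {n} → Graph n → Set
Connected G = ∀ u v → ∃ λ k → Walk (adj G) u v k

IsDist : ∀ {n} → Graph n → Fin n → Fin n → ℕ → Set
IsDist G u v k = Walk (adj G) u v k × (∀ m → Walk (adj G) u v m → k ≤ m)

OnGeodesic : ∀ {n} → Graph n → (Fin n → Fin n → ℕ) → Fin n → Fin n → Fin n → Set
OnGeodesic G d u v m = Σ ℕ λ a → Σ ℕ λ b →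
  Walk (adj G) u m a × Walk (adj G) m v b × (a + b ≡ d u v)

IsMedian : ∀ {n} → Graph n → (Fin n → Fin n → ℕ) → Fin n → Fin n → Fin n → Fin n → Set
IsMedian G d u v w m = OnGeodesic G d u v m × OnGeodesic G d u w m × OnGeodesic G d v w m

Modular : ∀ {n} → Graph n → (Fin n → Fin n → ℕ) → Set
Modular G d = ∀ u v w → ∃ λ m → IsMedian G d u v w m

record EdgeSubset {n : ℕ} (G : Graph n) : Set where
  field
    sub     : Fin n → Fin n → Bool
    sub-sym : ∀ i j → sub i j ≡ sub j i
    sub-adj : ∀ i j → sub i j ≡ true → adj G i j ≡ true
open EdgeSubset public

edgeCount : ∀ {n} {G : Graph n} → EdgeSubset G → ℕ
edgeCount F = ∑ λ i → ∑ λ j → [ i ≺ j ∧ sub F i j ]⇒ 1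

-- the edges of F span a connected subgraph whose vertex set contains {u,v,w}
-- (u,v,w are pairwise joined by walks in F)
Spans : ∀ {n} {G : Graph n} → EdgeSubset G → Fin n → Fin n → Fin n → Set
Spans F u v w = (∃ λ a → Walk (sub F) u v a) × (∃ λ b → Walk (sub F) u w b)
                × (∃ λ c → Walk (sub F) v w c)

IsSteiner3 : ∀ {n} → Graph n → Fin n → Fin n → Fin n → ℕ → Set
IsSteiner3 G u v w k =
  (Σ (EdgeSubset G) λ F → Spans F u v w × edgeCount F ≡ k)
  × (∀ (F : EdgeSubset G) → Spans F u v w → k ≤ edgeCount F)

sum3 : ∀ {n} → (Fin n → Fin n → Fin n → ℕ) → ℕ
sum3 f = ∑ λ i → ∑ λ j → ∑ λ k → [ i ≺ j ∧ j ≺ k ]⇒ f i j k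

Wiener : ∀ {n} → (Fin n → Fin n → ℕ) → ℕ
Wiener d = ∑ λ i → ∑ λ j → [ i ≺ j ]⇒ d i j

WWbar : ∀ {n} → (Fin n → Fin n → ℕ) → ℕ
WWbar d = ∑ λ i → ∑ λ j → [ i ≺ j ]⇒ (d i j * d i j)

WWhat : ∀ {n} → (Fin n → Fin n → ℕ) → ℕ
WWhat d = ∑ λ u → ∑ λ v → ∑ λ w →
  [ u ≢ᵇ v ∧ u ≢ᵇ w ∧ v ≢ᵇ w ]⇒ (d u v * d u w)

-- 2 · SWW₃(G) = Σ_S d(S) + Σ_S d(S)²   (kept in ℕ to avoid fractions)
twiceSWW3 : ∀ {n} → (Fin n → Fin n → Fin n → ℕ) → ℕ
twiceSWW3 ds = sum3 ds + sum3 (λ i j k → ds i j k * ds i j k)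

-- Let u, v, w be distinct and m a median of them in the modular graph G. The union of
-- three geodesics from m connects u, v, w with d(m,u) + d(m,v) + d(m,w) edges. Conversely,
-- a path from u to v in any connected subgraph through u, v and w contains, for each
-- r < d(m,u), an edge joining the distance levels r and r + 1 around u; likewise around v
-- (for r < d(m,v)) and w (for r < d(m,w)), and since m lies on all three geodesics between
-- u, v, w the triangle inequality makes all these edges distinct. Hence
-- 2 d({u,v,w}) = d(u,v) + d(u,w) + d(v,w), so 4 (d(S) + d(S)²) = 2 (a + b + c) + (a + b + c)²
-- with a, b, c the three pairwise distances. Summed over 3-subsets, each pair lies in n - 2
-- of them, which produces (n - 2) W and (n - 2) WW̄, and the six mixed products d(x,y) d(x,z)
-- of a 3-subset are exactly its contributions to ŴW.
module Submission where

open import Defs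
open import Data.Nat using (ℕ; _+_; _*_; _∸_; _≤_)
open import Data.Fin using (Fin)
open import Relation.Binary.PropositionalEquality using (_≡_; _≢_)

open import Data.Bool using (Bool; true; false; not; _∧_; _∨_) renaming (_≟_ to _≟ᴮ_)
open import Data.Bool.Properties using (∧-zeroʳ; ∧-identityʳ; ∨-zeroʳ; ∧-comm; ∨-comm; ¬-not; T-≡)
open import Data.Empty using (⊥; ⊥-elim)
open import Data.Fin using (toℕ; _≟_; zero; suc)
import Data.Fin.Properties as Fin
open import Data.Nat using (zero; suc; _<_; _<ᵇ_; _≡ᵇ_; z≤n; s≤s)
open import Data.Nat.Properties hiding (_≟_)
open import Data.Nat.Properties using () renaming (_≟_ to _≟ℕ_)
open import Algebra.Properties.CommutativeMonoid.Sum +-0-commutativeMonoid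
  using (sum; sum-cong-≗; ∑-distrib-+; ∑-comm)
open import Algebra.Properties.Semiring.Sum +-*-semiring using (*-distribˡ-sum)
open import Data.Nat.Tactic.RingSolver using (solve-∀)
open import Data.Product using (Σ; _×_; _,_; proj₁; proj₂; ∃₂)
open import Data.Sum using (_⊎_; inj₁; inj₂; [_,_]′)
open import Function.Bundles using (Equivalence)
open import Relation.Binary.Definitions using (Tri; tri<; tri≈; tri>)
open import Relation.Binary.PropositionalEquality
  using (refl; sym; trans; cong; cong₂; subst; module ≡-Reasoning)
open import Relation.Nullary using (Dec; does; yes; no)
open import Relation.Nullary.Decidable using (dec-true)

-- Sums over Fin n

∑≡sum : ∀ {n} (f : Fin n → ℕ) → ∑ f ≡ sum f
∑≡sum {zero}  f = refl
∑≡sum {suc n} f = cong (f zero +_) (∑≡sum (λ i → f (suc i)))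

∑-cong : ∀ {n} {f g : Fin n → ℕ} → (∀ i → f i ≡ g i) → ∑ f ≡ ∑ g
∑-cong {zero}  f≗g = refl
∑-cong {suc n} f≗g = cong₂ _+_ (f≗g zero) (∑-cong (λ i → f≗g (suc i)))

∑-+ : ∀ {n} (f g : Fin n → ℕ) → ∑ (λ i → f i + g i) ≡ ∑ f + ∑ g
∑-+ f g = begin
  ∑ (λ i → f i + g i)   ≡⟨ ∑≡sum (λ i → f i + g i) ⟩
  sum (λ i → f i + g i) ≡⟨ ∑-distrib-+ f g ⟩
  sum f + sum g         ≡⟨ sym (cong₂ _+_ (∑≡sum f) (∑≡sum g)) ⟩
  ∑ f + ∑ g             ∎
  where open ≡-Reasoning

*-distribˡ-∑ : ∀ {n} c (f : Fin n → ℕ) → c * ∑ f ≡ ∑ (λ i → c * f i)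
*-distribˡ-∑ c f = begin
  c * ∑ f               ≡⟨ cong (c *_) (∑≡sum f) ⟩
  c * sum f             ≡⟨ *-distribˡ-sum c f ⟩
  sum (λ i → c * f i)   ≡⟨ sym (∑≡sum (λ i → c * f i)) ⟩
  ∑ (λ i → c * f i)     ∎
  where open ≡-Reasoning

∑-swap : ∀ {m n} (f : Fin m → Fin n → ℕ) →
         ∑ (λ i → ∑ (λ j → f i j)) ≡ ∑ (λ j → ∑ (λ i → f i j))
∑-swap f = begin
  ∑ (λ i → ∑ (f i))                 ≡⟨ ∑∑≡sumsum f ⟩
  sum (λ i → sum (f i))             ≡⟨ ∑-comm f ⟩
  sum (λ j → sum (λ i → f i j))     ≡⟨ sym (∑∑≡sumsum (λ j i → f i j)) ⟩
  ∑ (λ j → ∑ (λ i → f i j))         ∎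
  where
  open ≡-Reasoning
  ∑∑≡sumsum : ∀ {m n} (g : Fin m → Fin n → ℕ) → ∑ (λ i → ∑ (g i)) ≡ sum (λ i → sum (g i))
  ∑∑≡sumsum g = trans (∑≡sum (λ i → ∑ (g i))) (sum-cong-≗ (λ i → ∑≡sum (g i)))

∑-const : ∀ {n} c → ∑ {n} (λ _ → c) ≡ n * c
∑-const {zero}  c = refl
∑-const {suc n} c = cong (c +_) (∑-const {n} c)

∑-zero : ∀ {n} → ∑ {n} (λ _ → 0) ≡ 0
∑-zero {n} = trans (∑-const {n} 0) (*-zeroʳ n)

∑∑-+ : ∀ {m n} (f g : Fin m → Fin n → ℕ) →
        ∑ (λ i → ∑ λ j → f i j + g i j) ≡ ∑ (λ i → ∑ (f i)) + ∑ (λ i → ∑ (g i))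
∑∑-+ f g = trans (∑-cong λ i → ∑-+ (f i) (g i)) (∑-+ (λ i → ∑ (f i)) (λ i → ∑ (g i)))

∑-mono-≤ : ∀ {n} {f g : Fin n → ℕ} → (∀ i → f i ≤ g i) → ∑ f ≤ ∑ g
∑-mono-≤ {zero}  f≤g = z≤n
∑-mono-≤ {suc n} f≤g = +-mono-≤ (f≤g zero) (∑-mono-≤ (λ i → f≤g (suc i)))

≤-∑ : ∀ {n} (f : Fin n → ℕ) i → f i ≤ ∑ f
≤-∑ f zero    = m≤m+n _ _
≤-∑ f (suc i) = ≤-trans (≤-∑ (λ j → f (suc j)) i) (m≤n+m _ (f zero))

≤-∑∑ : ∀ {m n} (f : Fin m → Fin n → ℕ) i j → f i j ≤ ∑ (λ i → ∑ (f i))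
≤-∑∑ f i j = ≤-trans (≤-∑ (f i) j) (≤-∑ (λ i → ∑ (f i)) i)

∧-true⁻ : ∀ {x y} → x ∧ y ≡ true → x ≡ true × y ≡ true
∧-true⁻ {true} {true} _ = refl , refl

∧-true⁺ : ∀ {x y} → x ≡ true → y ≡ true → x ∧ y ≡ true
∧-true⁺ refl refl = refl

∨-true⁻ : ∀ {x y} → x ∨ y ≡ true → x ≡ true ⊎ y ≡ true
∨-true⁻ {true}  _   = inj₁ refl
∨-true⁻ {false} y≡t = inj₂ y≡t

∨-trueˡ : ∀ {x} y → x ≡ true → x ∨ y ≡ true
∨-trueˡ y refl = refl

∨-trueʳ : ∀ x {y} → y ≡ true → x ∨ y ≡ true
∨-trueʳ x refl = ∨-zeroʳ x

does-true⇒ : ∀ {A : Set} (a? : Dec A) → does a? ≡ true → A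
does-true⇒ (yes a) _ = a

[]⇒-+ : ∀ b x y → [ b ]⇒ (x + y) ≡ [ b ]⇒ x + [ b ]⇒ y
[]⇒-+ true  x y = refl
[]⇒-+ false x y = refl

*-[]⇒ : ∀ c b x → c * [ b ]⇒ x ≡ [ b ]⇒ (c * x)
*-[]⇒ c true  x = refl
*-[]⇒ c false x = *-zeroʳ c

[]⇒-∑ : ∀ {n} b (f : Fin n → ℕ) → [ b ]⇒ ∑ f ≡ ∑ (λ k → [ b ]⇒ f k)
[]⇒-∑ true      f = refl
[]⇒-∑ {n} false f = sym (∑-zero {n})

[]⇒-∧ : ∀ b₁ b₂ x → [ b₁ ]⇒ ([ b₂ ]⇒ x) ≡ [ b₁ ∧ b₂ ]⇒ x
[]⇒-∧ true  b₂ x = refl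
[]⇒-∧ false b₂ x = refl

[]⇒-cong : ∀ b {x y} → (b ≡ true → x ≡ y) → [ b ]⇒ x ≡ [ b ]⇒ y
[]⇒-cong true  x≡y = x≡y refl
[]⇒-cong false x≡y = refl

[]⇒-mono-≤ : ∀ b {x y} → x ≤ y → [ b ]⇒ x ≤ [ b ]⇒ y
[]⇒-mono-≤ true  x≤y = x≤y
[]⇒-mono-≤ false x≤y = z≤n

∑-[≟]⇒ : ∀ {n} (a : Fin n) x → ∑ (λ i → [ does (a ≟ i) ]⇒ x) ≡ x
∑-[≟]⇒ {suc n} zero    x = trans (cong (x +_) (∑-zero {n})) (+-identityʳ x)
∑-[≟]⇒ {suc n} (suc a) x = ∑-[≟]⇒ a x

[∧∨]⇒1-≤ : ∀ t x y → [ t ∧ (x ∨ y) ]⇒ 1 ≤ [ t ∧ x ]⇒ 1 + [ t ∧ y ]⇒ 1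
[∧∨]⇒1-≤ false x     y     = z≤n
[∧∨]⇒1-≤ true  true  y     = s≤s z≤n
[∧∨]⇒1-≤ true  false true  = s≤s z≤n
[∧∨]⇒1-≤ true  false false = z≤n

∑∑-point : ∀ {n} (a b : Fin n) x →
           ∑ (λ i → ∑ λ j → [ does (a ≟ i) ∧ does (b ≟ j) ]⇒ x) ≡ x
∑∑-point a b x = begin
  ∑ (λ i → ∑ λ j → [ does (a ≟ i) ∧ does (b ≟ j) ]⇒ x)
    ≡⟨ ∑-cong (λ i → ∑-cong λ j → sym ([]⇒-∧ (does (a ≟ i)) (does (b ≟ j)) x)) ⟩
  ∑ (λ i → ∑ λ j → [ does (a ≟ i) ]⇒ ([ does (b ≟ j) ]⇒ x))
    ≡⟨ ∑-cong (λ i → sym ([]⇒-∑ (does (a ≟ i)) (λ j → [ does (b ≟ j) ]⇒ x))) ⟩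
  ∑ (λ i → [ does (a ≟ i) ]⇒ ∑ λ j → [ does (b ≟ j) ]⇒ x)
    ≡⟨ ∑-cong (λ i → cong ([ does (a ≟ i) ]⇒_) (∑-[≟]⇒ b x)) ⟩
  ∑ (λ i → [ does (a ≟ i) ]⇒ x)
    ≡⟨ ∑-[≟]⇒ a x ⟩
  x ∎
  where open ≡-Reasoning

count-vanishes : ∀ {K} (P : Fin K → Bool) → (∀ r → P r ≢ true) → ∑ (λ r → [ P r ]⇒ 1) ≡ 0
count-vanishes {zero}  P none = refl
count-vanishes {suc K} P none rewrite ¬-not (none zero) =
  count-vanishes (λ r → P (suc r)) (λ r → none (suc r))

count-unique≤1 : ∀ {K} (P : Fin K → Bool) → (∀ r s → P r ≡ true → P s ≡ true → r ≡ s) →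
                 ∑ (λ r → [ P r ]⇒ 1) ≤ 1
count-unique≤1 {zero}  P unique = z≤n
count-unique≤1 {suc K} P unique with P zero in P0
... | true  = ≤-reflexive (cong suc (count-vanishes (λ r → P (suc r))
                (λ r Pr → Fin.0≢1+n (unique zero (suc r) P0 Pr))))
... | false = count-unique≤1 (λ r → P (suc r)) λ r s Pr Ps → Fin.suc-injective (unique _ _ Pr Ps)

at-most-one-positive : ∀ {a b c} →
  (a ≤ 1 × b ≡ 0 × c ≡ 0) ⊎ (a ≡ 0 × b ≤ 1 × c ≡ 0) ⊎ (a ≡ 0 × b ≡ 0 × c ≤ 1) → a + b + c ≤ 1
at-most-one-positive (inj₁ (a≤1 , refl , refl)) =
  subst (_≤ 1) (sym (trans (+-identityʳ _) (+-identityʳ _))) a≤1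
at-most-one-positive (inj₂ (inj₁ (refl , b≤1 , refl))) = subst (_≤ 1) (sym (+-identityʳ _)) b≤1
at-most-one-positive (inj₂ (inj₂ (refl , refl , c≤1))) = c≤1

≤-∑-hits : ∀ {K m} (S : Fin m → Fin m → Bool) (L : Fin K → Fin m → Fin m → Bool) →
               (∀ r → ∃₂ λ i j → S i j ≡ true × L r i j ≡ true) →
               K ≤ ∑ λ i → ∑ λ j → [ S i j ]⇒ ∑ (λ r → [ L r i j ]⇒ 1)
≤-∑-hits {K} {m} S L hit = begin
  K                                   ≡⟨ sym (trans (∑-const {K} 1) (*-identityʳ K)) ⟩
  ∑ {K} (λ _ → 1)                     ≤⟨ ∑-mono-≤ one-hit ⟩
  ∑ (λ r → ∑ λ i → ∑ λ j → g r i j)   ≡⟨ ∑-swap (λ r i → ∑ (g r i)) ⟩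
  ∑ (λ i → ∑ λ r → ∑ λ j → g r i j)   ≡⟨ ∑-cong (λ i → ∑-swap (λ r j → g r i j)) ⟩
  ∑ (λ i → ∑ λ j → ∑ λ r → g r i j)
    ≡⟨ sym (∑-cong λ i → ∑-cong λ j → []⇒-∑ (S i j) (λ r → [ L r i j ]⇒ 1)) ⟩
  ∑ (λ i → ∑ λ j → [ S i j ]⇒ ∑ (λ r → [ L r i j ]⇒ 1)) ∎
  where
  open ≤-Reasoning
  g : Fin K → Fin m → Fin m → ℕ
  g r i j = [ S i j ]⇒ ([ L r i j ]⇒ 1)
  one-hit : ∀ r → 1 ≤ ∑ λ i → ∑ λ j → g r i j
  one-hit r with hit r
  ... | i , j , Sij , Lrij =
    ≤-trans (≤-reflexive (cong₂ (λ s l → [ s ]⇒ ([ l ]⇒ 1)) (sym Sij) (sym Lrij))) (≤-∑∑ (g r) i j)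

≢ᵇ-by-order : ∀ a b x → [ not (a ≡ᵇ b) ]⇒ x ≡ [ (a <ᵇ b) ]⇒ x + [ (b <ᵇ a) ]⇒ x
≢ᵇ-by-order zero    zero    x = refl
≢ᵇ-by-order zero    (suc b) x = sym (+-identityʳ x)
≢ᵇ-by-order (suc a) zero    x = refl
≢ᵇ-by-order (suc a) (suc b) x = ≢ᵇ-by-order a b x

outside-by-position : ∀ a b c x →
  [ (a <ᵇ b) ∧ not (a ≡ᵇ c) ∧ not (b ≡ᵇ c) ]⇒ x
    ≡ [ (c <ᵇ a) ∧ (a <ᵇ b) ]⇒ x + [ (a <ᵇ c) ∧ (c <ᵇ b) ]⇒ x + [ (a <ᵇ b) ∧ (b <ᵇ c) ]⇒ x
outside-by-position zero    zero    zero    x = refl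
outside-by-position zero    zero    (suc c) x = refl
outside-by-position zero    (suc b) zero    x = refl
outside-by-position zero    (suc b) (suc c) x = trans (≢ᵇ-by-order b c x) (+-comm ([ (b <ᵇ c) ]⇒ x) _)
outside-by-position (suc a) zero    zero    x = refl
outside-by-position (suc a) zero    (suc c) x
  rewrite ∧-zeroʳ (c <ᵇ a) | ∧-zeroʳ (a <ᵇ c) = refl
outside-by-position (suc a) (suc b) zero    x
  rewrite ∧-zeroʳ (a <ᵇ b) | ∧-identityʳ (a <ᵇ b) = sym (trans (+-identityʳ _) (+-identityʳ _))
outside-by-position (suc a) (suc b) (suc c) x = outside-by-position a b c x

distinct-by-order : ∀ a b c x →
  [ not (a ≡ᵇ b) ∧ not (a ≡ᵇ c) ∧ not (b ≡ᵇ c) ]⇒ x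
    ≡ [ (a <ᵇ b) ∧ not (a ≡ᵇ c) ∧ not (b ≡ᵇ c) ]⇒ x + [ (b <ᵇ a) ∧ not (b ≡ᵇ c) ∧ not (a ≡ᵇ c) ]⇒ x
distinct-by-order zero    zero    zero    x = refl
distinct-by-order zero    zero    (suc c) x = refl
distinct-by-order zero    (suc b) zero    x = refl
distinct-by-order zero    (suc b) (suc c) x = sym (+-identityʳ _)
distinct-by-order (suc a) zero    zero    x = refl
distinct-by-order (suc a) zero    (suc c) x
  rewrite ∧-identityʳ (not (a ≡ᵇ c)) = refl
distinct-by-order (suc a) (suc b) zero    x
  rewrite ∧-identityʳ (not (a ≡ᵇ b)) | ∧-identityʳ (a <ᵇ b) | ∧-identityʳ (b <ᵇ a) = ≢ᵇ-by-order a b x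
distinct-by-order (suc a) (suc b) (suc c) x = distinct-by-order a b c x

outside-or-equal : ∀ a b c x → (a <ᵇ b) ≡ true →
  [ not (a ≡ᵇ c) ∧ not (b ≡ᵇ c) ]⇒ x + [ a ≡ᵇ c ]⇒ x + [ b ≡ᵇ c ]⇒ x ≡ x
outside-or-equal zero    (suc b) zero    x a<b = +-identityʳ x
outside-or-equal zero    (suc b) (suc c) x a<b with b ≡ᵇ c
... | true  = refl
... | false = trans (+-identityʳ (x + 0)) (+-identityʳ x)
outside-or-equal (suc a) (suc b) zero    x a<b = trans (+-identityʳ (x + 0)) (+-identityʳ x)
outside-or-equal (suc a) (suc b) (suc c) x a<b = outside-or-equal a b c x a<b

<ᵇ-asym : ∀ a b → [ (a <ᵇ b) ]⇒ 1 + [ (b <ᵇ a) ]⇒ 1 ≤ 1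
<ᵇ-asym zero    zero    = z≤n
<ᵇ-asym zero    (suc b) = s≤s z≤n
<ᵇ-asym (suc a) zero    = s≤s z≤n
<ᵇ-asym (suc a) (suc b) = <ᵇ-asym a b

does-≟ : ∀ {n} (i j : Fin n) → does (i ≟ j) ≡ (toℕ i ≡ᵇ toℕ j)
does-≟ zero    zero    = refl
does-≟ zero    (suc j) = refl
does-≟ (suc i) zero    = refl
does-≟ (suc i) (suc j) = does-≟ i j

<⇒≺ : ∀ {n} {i j : Fin n} → toℕ i < toℕ j → (i ≺ j) ≡ true
<⇒≺ i<j = Equivalence.to T-≡ (<⇒<ᵇ i<j)

≺⇒< : ∀ {n} {i j : Fin n} → (i ≺ j) ≡ true → toℕ i < toℕ j
≺⇒< {i = i} {j} i≺j = <ᵇ⇒< (toℕ i) (toℕ j) (Equivalence.from T-≡ i≺j)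

ordered⇒distinct : ∀ {n} {i j k : Fin n} → (i ≺ j ∧ j ≺ k) ≡ true → i ≢ j × i ≢ k × j ≢ k
ordered⇒distinct {i = i} {j} {k} i≺j≺k =
    (λ { refl → <-irrefl refl i<j })
  , (λ { refl → <-asym i<j j<k })
  , (λ { refl → <-irrefl refl j<k })
  where
  i<j : toℕ i < toℕ j
  i<j = ≺⇒< {i = i} {j} (proj₁ (∧-true⁻ {i ≺ j} i≺j≺k))
  j<k : toℕ j < toℕ k
  j<k = ≺⇒< {i = j} {k} (proj₂ (∧-true⁻ {i ≺ j} i≺j≺k))

-- Sums over triples

module _ {n : ℕ} where

  ∑³ : (Fin n → Fin n → Fin n → ℕ) → ℕ
  ∑³ g = ∑ λ a → ∑ λ b → ∑ λ c → g a b c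

  ∑³-cong : ∀ {f g} → (∀ a b c → f a b c ≡ g a b c) → ∑³ f ≡ ∑³ g
  ∑³-cong f≗g = ∑-cong λ a → ∑-cong λ b → ∑-cong λ c → f≗g a b c

  ∑³-+ : ∀ f g → ∑³ (λ a b c → f a b c + g a b c) ≡ ∑³ f + ∑³ g
  ∑³-+ f g = begin
    ∑³ (λ a b c → f a b c + g a b c)
      ≡⟨ ∑-cong (λ a → ∑-cong (λ b → ∑-+ (f a b) (g a b))) ⟩
    ∑ (λ a → ∑ λ b → ∑ (f a b) + ∑ (g a b))
      ≡⟨ ∑-cong (λ a → ∑-+ (λ b → ∑ (f a b)) (λ b → ∑ (g a b))) ⟩
    ∑ (λ a → ∑ (λ b → ∑ (f a b)) + ∑ (λ b → ∑ (g a b)))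
      ≡⟨ ∑-+ (λ a → ∑ λ b → ∑ (f a b)) (λ a → ∑ λ b → ∑ (g a b)) ⟩
    ∑³ f + ∑³ g ∎
    where open ≡-Reasoning

  *-distribˡ-∑³ : ∀ c f → c * ∑³ f ≡ ∑³ (λ a b e → c * f a b e)
  *-distribˡ-∑³ c f = begin
    c * ∑³ f                             ≡⟨ *-distribˡ-∑ c (λ a → ∑ λ b → ∑ (f a b)) ⟩
    ∑ (λ a → c * ∑ λ b → ∑ (f a b))      ≡⟨ ∑-cong (λ a → *-distribˡ-∑ c (λ b → ∑ (f a b))) ⟩
    ∑ (λ a → ∑ λ b → c * ∑ (f a b))      ≡⟨ ∑-cong (λ a → ∑-cong (λ b → *-distribˡ-∑ c (f a b))) ⟩
    ∑³ (λ a b e → c * f a b e)           ∎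
    where open ≡-Reasoning

  ∑³-swap₁₂ : ∀ g → ∑³ g ≡ ∑³ (λ a b c → g b a c)
  ∑³-swap₁₂ g = ∑-swap (λ a b → ∑ (g a b))

  ∑³-swap₂₃ : ∀ g → ∑³ g ≡ ∑³ (λ a b c → g a c b)
  ∑³-swap₂₃ g = ∑-cong (λ a → ∑-swap (g a))

  ∑³-rotate : ∀ g → ∑³ g ≡ ∑³ (λ a b c → g b c a)
  ∑³-rotate g = trans (∑³-swap₂₃ g) (∑³-swap₁₂ (λ a b c → g a c b))

  sum3-cong : ∀ {f g} → (∀ i j k → (i ≺ j ∧ j ≺ k) ≡ true → f i j k ≡ g i j k) → sum3 f ≡ sum3 g
  sum3-cong f≗g = ∑³-cong λ i j k → []⇒-cong (i ≺ j ∧ j ≺ k) (f≗g i j k)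

  sum3-+ : ∀ f g → sum3 (λ i j k → f i j k + g i j k) ≡ sum3 f + sum3 g
  sum3-+ f g = trans (∑³-cong λ i j k → []⇒-+ (i ≺ j ∧ j ≺ k) (f i j k) (g i j k)) (∑³-+ _ _)

  *-distribˡ-sum3 : ∀ c f → c * sum3 f ≡ sum3 (λ i j k → c * f i j k)
  *-distribˡ-sum3 c f = trans (*-distribˡ-∑³ c _) (∑³-cong λ i j k → *-[]⇒ c (i ≺ j ∧ j ≺ k) (f i j k))

  -- For i < j < k, the three ways of splitting {i, j, k} into a pair p < q and a third point r.
  placements : (Fin n → Fin n → Fin n → ℕ) → Fin n → Fin n → Fin n → ℕ
  placements h i j k = h j k i + h i k j + h i j k

  outside-sum : ∀ h →
    ∑³ (λ p q r → [ p ≺ q ∧ p ≢ᵇ r ∧ q ≢ᵇ r ]⇒ h p q r) ≡ sum3 (placements h)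
  outside-sum h = begin
    ∑³ (λ p q r → [ p ≺ q ∧ p ≢ᵇ r ∧ q ≢ᵇ r ]⇒ h p q r)
      ≡⟨ ∑³-cong by-position ⟩
    ∑³ (λ p q r → before p q r + between p q r + after p q r)
      ≡⟨ ∑³-+ (λ p q r → before p q r + between p q r) after ⟩
    ∑³ (λ p q r → before p q r + between p q r) + ∑³ after
      ≡⟨ cong (_+ ∑³ after) (∑³-+ before between) ⟩
    ∑³ before + ∑³ between + ∑³ after
      ≡⟨ cong₂ (λ s t → s + t + ∑³ after) (∑³-rotate before) (∑³-swap₂₃ between) ⟩
    sum3 (λ i j k → h j k i) + sum3 (λ i j k → h i k j) + sum3 (λ i j k → h i j k)
      ≡⟨ cong (_+ sum3 (λ i j k → h i j k)) (sym (sum3-+ (λ i j k → h j k i) (λ i j k → h i k j))) ⟩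
    sum3 (λ i j k → h j k i + h i k j) + sum3 (λ i j k → h i j k)
      ≡⟨ sym (sum3-+ (λ i j k → h j k i + h i k j) (λ i j k → h i j k)) ⟩
    sum3 (placements h) ∎
    where
    open ≡-Reasoning
    before between after : Fin n → Fin n → Fin n → ℕ
    before  p q r = [ r ≺ p ∧ p ≺ q ]⇒ h p q r
    between p q r = [ p ≺ r ∧ r ≺ q ]⇒ h p q r
    after   p q r = [ p ≺ q ∧ q ≺ r ]⇒ h p q r
    by-position : ∀ p q r → [ p ≺ q ∧ p ≢ᵇ r ∧ q ≢ᵇ r ]⇒ h p q r
                            ≡ before p q r + between p q r + after p q r
    by-position p q r rewrite does-≟ p r | does-≟ q r =
      outside-by-position (toℕ p) (toℕ q) (toℕ r) (h p q r)

  ∑-outside-pair : ∀ {p q : Fin n} x → (p ≺ q) ≡ true →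
                   ∑ (λ r → [ p ≢ᵇ r ∧ q ≢ᵇ r ]⇒ x) ≡ (n ∸ 2) * x
  ∑-outside-pair {p} {q} x p≺q = begin
    A                  ≡⟨ sym (m+n∸n≡m A (x + x)) ⟩
    A + (x + x) ∸ (x + x) ≡⟨ cong (_∸ (x + x)) A+2x≡nx ⟩
    n * x ∸ (x + x)    ≡⟨ cong (n * x ∸_) (cong (x +_) (sym (+-identityʳ x))) ⟩
    n * x ∸ 2 * x      ≡⟨ sym (*-distribʳ-∸ x n 2) ⟩
    (n ∸ 2) * x        ∎
    where
    open ≡-Reasoning
    A = ∑ (λ r → [ p ≢ᵇ r ∧ q ≢ᵇ r ]⇒ x)
    split : ∀ r → [ p ≢ᵇ r ∧ q ≢ᵇ r ]⇒ x + [ does (p ≟ r) ]⇒ x + [ does (q ≟ r) ]⇒ x ≡ x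
    split r rewrite does-≟ p r | does-≟ q r = outside-or-equal (toℕ p) (toℕ q) (toℕ r) x p≺q
    A+2x≡nx : A + (x + x) ≡ n * x
    A+2x≡nx = begin
      A + (x + x)
        ≡⟨ sym (+-assoc A x x) ⟩
      A + x + x
        ≡⟨ sym (cong₂ (λ s t → A + s + t) (∑-[≟]⇒ p x) (∑-[≟]⇒ q x)) ⟩
      A + ∑ (λ r → [ does (p ≟ r) ]⇒ x) + ∑ (λ r → [ does (q ≟ r) ]⇒ x)
        ≡⟨ cong (_+ ∑ (λ r → [ does (q ≟ r) ]⇒ x)) (sym (∑-+ _ (λ r → [ does (p ≟ r) ]⇒ x))) ⟩
      ∑ (λ r → [ p ≢ᵇ r ∧ q ≢ᵇ r ]⇒ x + [ does (p ≟ r) ]⇒ x) + ∑ (λ r → [ does (q ≟ r) ]⇒ x)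
        ≡⟨ sym (∑-+ _ (λ r → [ does (q ≟ r) ]⇒ x)) ⟩
      ∑ (λ r → [ p ≢ᵇ r ∧ q ≢ᵇ r ]⇒ x + [ does (p ≟ r) ]⇒ x + [ does (q ≟ r) ]⇒ x)
        ≡⟨ ∑-cong split ⟩
      ∑ {n} (λ _ → x)
        ≡⟨ ∑-const {n} x ⟩
      n * x ∎

  Wiener-as-sum3 : ∀ h → (n ∸ 2) * Wiener h ≡ sum3 (placements (λ p q _ → h p q))
  Wiener-as-sum3 h = begin
    (n ∸ 2) * Wiener h
      ≡⟨ *-distribˡ-∑ (n ∸ 2) (λ p → ∑ λ q → [ p ≺ q ]⇒ h p q) ⟩
    ∑ (λ p → (n ∸ 2) * ∑ λ q → [ p ≺ q ]⇒ h p q)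
      ≡⟨ ∑-cong (λ p → *-distribˡ-∑ (n ∸ 2) (λ q → [ p ≺ q ]⇒ h p q)) ⟩
    ∑ (λ p → ∑ λ q → (n ∸ 2) * [ p ≺ q ]⇒ h p q)
      ≡⟨ ∑-cong (λ p → ∑-cong (λ q → spread p q)) ⟩
    ∑³ (λ p q r → [ p ≺ q ∧ p ≢ᵇ r ∧ q ≢ᵇ r ]⇒ h p q)
      ≡⟨ outside-sum (λ p q _ → h p q) ⟩
    sum3 (placements (λ p q _ → h p q)) ∎
    where
    open ≡-Reasoning
    spread : ∀ p q → (n ∸ 2) * [ p ≺ q ]⇒ h p q ≡ ∑ (λ r → [ p ≺ q ∧ p ≢ᵇ r ∧ q ≢ᵇ r ]⇒ h p q)
    spread p q with p ≺ q in p≺q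
    ... | true  = sym (∑-outside-pair {p} {q} (h p q) p≺q)
    ... | false = trans (*-zeroʳ (n ∸ 2)) (sym (∑-zero {n}))

  WWhat-as-sum3 : ∀ d → WWhat d ≡ sum3 (placements (λ u v w → d u v * d u w))
                                   + sum3 (placements (λ u v w → d v u * d v w))
  WWhat-as-sum3 d = begin
    WWhat d
      ≡⟨ ∑³-cong by-order ⟩
    ∑³ (λ u v w → first u v w + second u v w)
      ≡⟨ ∑³-+ first second ⟩
    ∑³ first + ∑³ second
      ≡⟨ cong (∑³ first +_) (∑³-swap₁₂ second) ⟩
    ∑³ first + ∑³ (λ u v w → second v u w)
      ≡⟨ cong₂ _+_ (outside-sum (λ u v w → d u v * d u w)) (outside-sum (λ u v w → d v u * d v w)) ⟩
    sum3 (placements (λ u v w → d u v * d u w)) + sum3 (placements (λ u v w → d v u * d v w)) ∎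
    where
    open ≡-Reasoning
    first second : Fin n → Fin n → Fin n → ℕ
    first  u v w = [ u ≺ v ∧ u ≢ᵇ w ∧ v ≢ᵇ w ]⇒ (d u v * d u w)
    second u v w = [ v ≺ u ∧ v ≢ᵇ w ∧ u ≢ᵇ w ]⇒ (d u v * d u w)
    by-order : ∀ u v w → [ u ≢ᵇ v ∧ u ≢ᵇ w ∧ v ≢ᵇ w ]⇒ (d u v * d u w) ≡ first u v w + second u v w
    by-order u v w rewrite does-≟ u v | does-≟ u w | does-≟ v w =
      distinct-by-order (toℕ u) (toℕ v) (toℕ w) (d u v * d u w)

half-perimeter-square : ∀ s a b c → 2 * s ≡ a + b + c →
  4 * (s + s * s) ≡ 2 * (c + b + a) + (c * c + b * b + a * a)
                    + ((c * a + b * a + a * b) + (c * b + b * c + a * c))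
half-perimeter-square s a b c 2s≡a+b+c =
  trans (double s) (trans (cong (λ t → 2 * t + t * t) 2s≡a+b+c) (expand a b c))
  where
  double : ∀ s → 4 * (s + s * s) ≡ 2 * (2 * s) + 2 * s * (2 * s)
  double = solve-∀
  expand : ∀ a b c → 2 * (a + b + c) + (a + b + c) * (a + b + c)
    ≡ 2 * (c + b + a) + (c * c + b * b + a * a) + ((c * a + b * a + a * b) + (c * b + b * c + a * c))
  expand = solve-∀

SWW3-from-half-perimeter : ∀ {n} (d : Fin n → Fin n → ℕ) (ds : Fin n → Fin n → Fin n → ℕ) →
  (∀ i j → d i j ≡ d j i) →
  (∀ i j k → (i ≺ j ∧ j ≺ k) ≡ true → 2 * ds i j k ≡ d i j + d i k + d j k) →
  4 * twiceSWW3 ds ≡ 2 * (n ∸ 2) * Wiener d + (n ∸ 2) * WWbar d + WWhat d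
SWW3-from-half-perimeter {n} d ds d-sym 2ds≡ = begin
  4 * twiceSWW3 ds
    ≡⟨ cong (4 *_) (sym (sum3-+ ds (λ i j k → ds i j k * ds i j k))) ⟩
  4 * sum3 (λ i j k → ds i j k + ds i j k * ds i j k)
    ≡⟨ *-distribˡ-sum3 4 (λ i j k → ds i j k + ds i j k * ds i j k) ⟩
  sum3 (λ i j k → 4 * (ds i j k + ds i j k * ds i j k))
    ≡⟨ sum3-cong expand ⟩
  sum3 (λ i j k → 2 * dist i j k + dist² i j k + cross i j k)
    ≡⟨ sum3-+ (λ i j k → 2 * dist i j k + dist² i j k) cross ⟩
  sum3 (λ i j k → 2 * dist i j k + dist² i j k) + sum3 cross
    ≡⟨ cong (_+ sum3 cross) (sum3-+ (λ i j k → 2 * dist i j k) dist²) ⟩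
  sum3 (λ i j k → 2 * dist i j k) + sum3 dist² + sum3 cross
    ≡⟨ cong (λ s → s + sum3 dist² + sum3 cross) (sym (*-distribˡ-sum3 2 dist)) ⟩
  2 * sum3 dist + sum3 dist² + sum3 cross
    ≡⟨ sym (cong₂ (λ s t → 2 * s + t + sum3 cross)
                  (Wiener-as-sum3 d) (Wiener-as-sum3 (λ i j → d i j * d i j))) ⟩
  2 * ((n ∸ 2) * Wiener d) + (n ∸ 2) * WWbar d + sum3 cross
    ≡⟨ cong₂ (λ s t → s + (n ∸ 2) * WWbar d + t) (sym (*-assoc 2 (n ∸ 2) (Wiener d)))
             (trans (sum3-+ (placements g) (placements (λ u v w → g v u w))) (sym (WWhat-as-sum3 d))) ⟩
  2 * (n ∸ 2) * Wiener d + (n ∸ 2) * WWbar d + WWhat d ∎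
  where
  open ≡-Reasoning
  g : Fin n → Fin n → Fin n → ℕ
  g u v w = d u v * d u w
  dist dist² cross : Fin n → Fin n → Fin n → ℕ
  dist  = placements (λ p q _ → d p q)
  dist² = placements (λ p q _ → d p q * d p q)
  cross i j k = placements g i j k + placements (λ u v w → g v u w) i j k
  expand : ∀ i j k → (i ≺ j ∧ j ≺ k) ≡ true →
           4 * (ds i j k + ds i j k * ds i j k) ≡ 2 * dist i j k + dist² i j k + cross i j k
  expand i j k i≺j≺k rewrite d-sym j i | d-sym k i | d-sym k j =
    half-perimeter-square (ds i j k) (d i j) (d i k) (d j k) (2ds≡ i j k i≺j≺k)

-- Walks and edge subsets

module _ {n : ℕ} where

  infixr 5 _++ʷ_
  _++ʷ_ : ∀ {E : Fin n → Fin n → Bool} {a b c k l} →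
          Walk E a b k → Walk E b c l → Walk E a c (k + l)
  here       ++ʷ W = W
  step e V   ++ʷ W = step e (V ++ʷ W)

  Walk-map : ∀ {E E′ : Fin n → Fin n → Bool} {a b k} →
             (∀ i j → E i j ≡ true → E′ i j ≡ true) → Walk E a b k → Walk E′ a b k
  Walk-map E⊆E′ here       = here
  Walk-map E⊆E′ (step e W) = step (E⊆E′ _ _ e) (Walk-map E⊆E′ W)

  Walk-reverse : ∀ {E : Fin n → Fin n → Bool} {a b k} →
                 (∀ i j → E i j ≡ E j i) → Walk E a b k → Walk E b a k
  Walk-reverse E-sym here = here
  Walk-reverse {E} E-sym (step {u} {v} {w} {k} e W) =
    subst (Walk E w u) (+-comm k 1) (Walk-reverse E-sym W ++ʷ step (trans (E-sym v u) e) here)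

  Walk-crossing : ∀ {E : Fin n → Fin n → Bool} (f : Fin n → ℕ) r {p q k} →
                  Walk E p q k → f p ≤ r → r < f q →
                  ∃₂ λ a b → E a b ≡ true × f a ≤ r × r < f b
  Walk-crossing f r here fp≤r r<fq = ⊥-elim (<⇒≱ r<fq fp≤r)
  Walk-crossing f r (step {p} {v} e W) fp≤r r<fq with f v ≤? r
  ... | yes fv≤r = Walk-crossing f r W fv≤r r<fq
  ... | no  fv≰r = p , v , e , fp≤r , ≰⇒> fv≰r

module _ {n : ℕ} {G : Graph n} where

  ∅ᴱ : EdgeSubset G
  ∅ᴱ = record { sub = λ _ _ → false ; sub-sym = λ _ _ → refl ; sub-adj = λ _ _ () }

  infixl 6 _∪ᴱ_
  _∪ᴱ_ : EdgeSubset G → EdgeSubset G → EdgeSubset G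
  F ∪ᴱ F′ = record
    { sub     = λ i j → sub F i j ∨ sub F′ i j
    ; sub-sym = λ i j → cong₂ _∨_ (sub-sym F i j) (sub-sym F′ i j)
    ; sub-adj = λ i j ij∈ → [ sub-adj F i j , sub-adj F′ i j ]′ (∨-true⁻ ij∈)
    }

  singleEdge : ∀ {a b} → adj G a b ≡ true → EdgeSubset G
  singleEdge {a} {b} ab = record { sub = is-ab ; sub-sym = is-ab-sym ; sub-adj = is-ab⇒adj }
    where
    is-ab : Fin n → Fin n → Bool
    is-ab i j = (does (a ≟ i) ∧ does (b ≟ j)) ∨ (does (b ≟ i) ∧ does (a ≟ j))
    is-ab-sym : ∀ i j → is-ab i j ≡ is-ab j i
    is-ab-sym i j = trans (∨-comm (does (a ≟ i) ∧ does (b ≟ j)) _)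
                          (cong₂ _∨_ (∧-comm (does (b ≟ i)) _) (∧-comm (does (a ≟ i)) _))
    is-ab⇒adj : ∀ i j → is-ab i j ≡ true → adj G i j ≡ true
    is-ab⇒adj i j ij∈ with ∨-true⁻ {does (a ≟ i) ∧ does (b ≟ j)} ij∈
    ... | inj₁ a=i∧b=j with does-true⇒ (a ≟ i) (proj₁ (∧-true⁻ a=i∧b=j))
                          | does-true⇒ (b ≟ j) (proj₂ (∧-true⁻ a=i∧b=j))
    ...   | refl | refl = ab
    is-ab⇒adj i j ij∈ | inj₂ b=i∧a=j with does-true⇒ (b ≟ i) (proj₁ (∧-true⁻ b=i∧a=j))
                                       | does-true⇒ (a ≟ j) (proj₂ (∧-true⁻ b=i∧a=j))
    ...   | refl | refl = trans (adj-sym G b a) ab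

  walkEdges : ∀ {a b k} → Walk (adj G) a b k → EdgeSubset G
  walkEdges here       = ∅ᴱ
  walkEdges (step e W) = singleEdge e ∪ᴱ walkEdges W

  Walk-∪ᴱˡ : ∀ F F′ {a b k} → Walk (sub F) a b k → Walk (sub (F ∪ᴱ F′)) a b k
  Walk-∪ᴱˡ F F′ = Walk-map λ i j → ∨-trueˡ (sub F′ i j)

  Walk-∪ᴱʳ : ∀ F F′ {a b k} → Walk (sub F′) a b k → Walk (sub (F ∪ᴱ F′)) a b k
  Walk-∪ᴱʳ F F′ = Walk-map λ i j → ∨-trueʳ (sub F i j)

  walkEdges-walk : ∀ {a b k} (W : Walk (adj G) a b k) → Walk (sub (walkEdges W)) a b k
  walkEdges-walk here                 = here
  walkEdges-walk (step {a} {b} ab W) =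
    step (∨-trueˡ _ a-b∈) (Walk-∪ᴱʳ (singleEdge ab) (walkEdges W) (walkEdges-walk W))
    where
    a-b∈ : (does (a ≟ a) ∧ does (b ≟ b)) ∨ (does (b ≟ a) ∧ does (a ≟ b)) ≡ true
    a-b∈ rewrite dec-true (a ≟ a) refl | dec-true (b ≟ b) refl = refl

  edgeCount-∅ᴱ : edgeCount ∅ᴱ ≡ 0
  edgeCount-∅ᴱ = trans (∑-cong {n} λ i → trans (∑-cong {n} λ j → cong ([_]⇒ 1) (∧-zeroʳ (i ≺ j)))
                                               (∑-zero {n}))
                       (∑-zero {n})

  edgeCount-∪ᴱ : ∀ F F′ → edgeCount (F ∪ᴱ F′) ≤ edgeCount F + edgeCount F′
  edgeCount-∪ᴱ F F′ = begin
    edgeCount (F ∪ᴱ F′)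
      ≤⟨ ∑-mono-≤ (λ i → ∑-mono-≤ λ j → [∧∨]⇒1-≤ (i ≺ j) (sub F i j) (sub F′ i j)) ⟩
    ∑ (λ i → ∑ λ j → [ i ≺ j ∧ sub F i j ]⇒ 1 + [ i ≺ j ∧ sub F′ i j ]⇒ 1)
      ≡⟨ ∑∑-+ (λ i j → [ i ≺ j ∧ sub F i j ]⇒ 1) (λ i j → [ i ≺ j ∧ sub F′ i j ]⇒ 1) ⟩
    edgeCount F + edgeCount F′ ∎
    where open ≤-Reasoning

  edgeCount-singleEdge : ∀ {a b} (ab : adj G a b ≡ true) → edgeCount (singleEdge ab) ≤ 1
  edgeCount-singleEdge {a} {b} ab = begin
    edgeCount (singleEdge ab)
      ≤⟨ ∑-mono-≤ (λ i → ∑-mono-≤ λ j → split i j) ⟩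
    ∑ (λ i → ∑ λ j → [ P a b i j ]⇒ ([ a ≺ b ]⇒ 1) + [ P b a i j ]⇒ ([ b ≺ a ]⇒ 1))
      ≡⟨ ∑∑-+ (λ i j → [ P a b i j ]⇒ ([ a ≺ b ]⇒ 1)) (λ i j → [ P b a i j ]⇒ ([ b ≺ a ]⇒ 1)) ⟩
    ∑ (λ i → ∑ λ j → [ P a b i j ]⇒ ([ a ≺ b ]⇒ 1)) + ∑ (λ i → ∑ λ j → [ P b a i j ]⇒ ([ b ≺ a ]⇒ 1))
      ≡⟨ cong₂ _+_ (∑∑-point a b ([ a ≺ b ]⇒ 1)) (∑∑-point b a ([ b ≺ a ]⇒ 1)) ⟩
    [ a ≺ b ]⇒ 1 + [ b ≺ a ]⇒ 1
      ≤⟨ <ᵇ-asym (toℕ a) (toℕ b) ⟩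
    1 ∎
    where
    open ≤-Reasoning
    P : Fin n → Fin n → Fin n → Fin n → Bool
    P a b i j = does (a ≟ i) ∧ does (b ≟ j)
    orient : ∀ a b i j → [ P a b i j ]⇒ ([ i ≺ j ]⇒ 1) ≡ [ P a b i j ]⇒ ([ a ≺ b ]⇒ 1)
    orient a b i j = []⇒-cong (P a b i j) λ a=i∧b=j →
      cong₂ (λ s t → [ s ≺ t ]⇒ 1) (sym (does-true⇒ (a ≟ i) (proj₁ (∧-true⁻ a=i∧b=j))))
                                   (sym (does-true⇒ (b ≟ j) (proj₂ (∧-true⁻ a=i∧b=j))))
    split : ∀ i j → [ i ≺ j ∧ (P a b i j ∨ P b a i j) ]⇒ 1
                    ≤ [ P a b i j ]⇒ ([ a ≺ b ]⇒ 1) + [ P b a i j ]⇒ ([ b ≺ a ]⇒ 1)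
    split i j = begin
      [ i ≺ j ∧ (P a b i j ∨ P b a i j) ]⇒ 1
        ≤⟨ [∧∨]⇒1-≤ (i ≺ j) (P a b i j) (P b a i j) ⟩
      [ i ≺ j ∧ P a b i j ]⇒ 1 + [ i ≺ j ∧ P b a i j ]⇒ 1
        ≡⟨ cong₂ _+_ (cong ([_]⇒ 1) (∧-comm (i ≺ j) _)) (cong ([_]⇒ 1) (∧-comm (i ≺ j) _)) ⟩
      [ P a b i j ∧ i ≺ j ]⇒ 1 + [ P b a i j ∧ i ≺ j ]⇒ 1
        ≡⟨ sym (cong₂ _+_ ([]⇒-∧ (P a b i j) (i ≺ j) 1) ([]⇒-∧ (P b a i j) (i ≺ j) 1)) ⟩
      [ P a b i j ]⇒ ([ i ≺ j ]⇒ 1) + [ P b a i j ]⇒ ([ i ≺ j ]⇒ 1)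
        ≡⟨ cong₂ _+_ (orient a b i j) (orient b a i j) ⟩
      [ P a b i j ]⇒ ([ a ≺ b ]⇒ 1) + [ P b a i j ]⇒ ([ b ≺ a ]⇒ 1) ∎

  edgeCount-walkEdges : ∀ {a b k} (W : Walk (adj G) a b k) → edgeCount (walkEdges W) ≤ k
  edgeCount-walkEdges here       = ≤-reflexive edgeCount-∅ᴱ
  edgeCount-walkEdges (step e W) =
    ≤-trans (edgeCount-∪ᴱ (singleEdge e) (walkEdges W))
            (+-mono-≤ (edgeCount-singleEdge e) (edgeCount-walkEdges W))

  Steiner-upper : ∀ {m u v w a b c} → Walk (adj G) m u a → Walk (adj G) m v b → Walk (adj G) m w c →
                  Σ (EdgeSubset G) λ F → Spans F u v w × edgeCount F ≤ a + b + c
  Steiner-upper Wu Wv Ww = F , spans , count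
    where
    Fu Fv Fw F : EdgeSubset G
    Fu = walkEdges Wu
    Fv = walkEdges Wv
    Fw = walkEdges Ww
    F  = Fu ∪ᴱ Fv ∪ᴱ Fw
    to-u = Walk-∪ᴱˡ (Fu ∪ᴱ Fv) Fw (Walk-∪ᴱˡ Fu Fv (walkEdges-walk Wu))
    to-v = Walk-∪ᴱˡ (Fu ∪ᴱ Fv) Fw (Walk-∪ᴱʳ Fu Fv (walkEdges-walk Wv))
    to-w = Walk-∪ᴱʳ (Fu ∪ᴱ Fv) Fw (walkEdges-walk Ww)
    from : ∀ {x y k} → Walk (sub F) x y k → Walk (sub F) y x k
    from = Walk-reverse (sub-sym F)
    spans : Spans F _ _ _
    spans = (_ , from to-u ++ʷ to-v) , (_ , from to-u ++ʷ to-w) , (_ , from to-v ++ʷ to-w)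
    count : edgeCount F ≤ _
    count = ≤-trans (edgeCount-∪ᴱ (Fu ∪ᴱ Fv) Fw)
              (+-mono-≤ (≤-trans (edgeCount-∪ᴱ Fu Fv)
                                 (+-mono-≤ (edgeCount-walkEdges Wu) (edgeCount-walkEdges Wv)))
                        (edgeCount-walkEdges Ww))

-- Distance layers and Steiner distances

suc-no-2-cycle : ∀ {r s : ℕ} → r ≡ suc s → s ≡ suc r → ⊥
suc-no-2-cycle refl s≡2+s = m≢1+n+m _ {1} s≡2+s

module Metric {n : ℕ} (G : Graph n) (d : Fin n → Fin n → ℕ)
              (d-dist : ∀ u v → IsDist G u v (d u v)) where

  d≤walk : ∀ {a b k} → Walk (adj G) a b k → d a b ≤ k
  d≤walk {a} {b} {k} W = proj₂ (d-dist a b) k W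

  geodesic : ∀ a b → Walk (adj G) a b (d a b)
  geodesic a b = proj₁ (d-dist a b)

  d-triangle : ∀ a b c → d a c ≤ d a b + d b c
  d-triangle a b c = d≤walk (geodesic a b ++ʷ geodesic b c)

  d-sym : ∀ a b → d a b ≡ d b a
  d-sym a b = ≤-antisym (d≤walk (back b a)) (d≤walk (back a b))
    where
    back : ∀ a b → Walk (adj G) b a (d a b)
    back a b = Walk-reverse (adj-sym G) (geodesic a b)

  d-refl : ∀ a → d a a ≡ 0
  d-refl a = n≤0⇒n≡0 (d≤walk here)

  d-step : ∀ c {a b} → adj G a b ≡ true → d c b ≤ suc (d c a)
  d-step c {a} {b} ab = subst (d c b ≤_) (+-comm (d c a) 1) (d≤walk (geodesic c a ++ʷ step ab here))

  median-split : ∀ {p q m} → OnGeodesic G d p q m → d m p + d m q ≡ d p q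
  median-split {p} {q} {m} (a , b , Wpm , Wmq , a+b≡) = ≤-antisym
    (≤-trans (+-mono-≤ (≤-trans (≤-reflexive (d-sym m p)) (d≤walk Wpm)) (d≤walk Wmq)) (≤-reflexive a+b≡))
    (≤-trans (d-triangle p m q) (≤-reflexive (cong (_+ d m q) (d-sym p m))))

  Layer : Fin n → ℕ → Fin n → Fin n → Bool
  Layer c r i j = (does (d c i ≟ℕ r) ∧ does (d c j ≟ℕ suc r))
                ∨ (does (d c j ≟ℕ r) ∧ does (d c i ≟ℕ suc r))

  Layer-ends : ∀ {c r i j} → Layer c r i j ≡ true →
               (d c i ≡ r × d c j ≡ suc r) ⊎ (d c j ≡ r × d c i ≡ suc r)
  Layer-ends {c} {r} {i} {j} ij∈ with ∨-true⁻ {does (d c i ≟ℕ r) ∧ does (d c j ≟ℕ suc r)} ij∈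
  ... | inj₁ low-high = let (low , high) = ∧-true⁻ low-high in
                        inj₁ (does-true⇒ (d c i ≟ℕ r) low , does-true⇒ (d c j ≟ℕ suc r) high)
  ... | inj₂ low-high = let (low , high) = ∧-true⁻ low-high in
                        inj₂ (does-true⇒ (d c j ≟ℕ r) low , does-true⇒ (d c i ≟ℕ suc r) high)

  Layer-intro : ∀ {c r i j} → d c i ≡ r → d c j ≡ suc r → Layer c r i j ≡ true
  Layer-intro {r = r} ci≡r cj≡1+r rewrite ci≡r | cj≡1+r | dec-true (r ≟ℕ r) refl = refl

  Layer-sym : ∀ c r i j → Layer c r i j ≡ Layer c r j i
  Layer-sym c r i j = ∨-comm (does (d c i ≟ℕ r) ∧ does (d c j ≟ℕ suc r)) _

  Layer-unique : ∀ {c r s i j} → Layer c r i j ≡ true → Layer c s i j ≡ true → r ≡ s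
  Layer-unique ij∈r ij∈s with Layer-ends ij∈r | Layer-ends ij∈s
  ... | inj₁ (i-r , _)   | inj₁ (i-s , _)   = trans (sym i-r) i-s
  ... | inj₂ (j-r , _)   | inj₂ (j-s , _)   = trans (sym j-r) j-s
  ... | inj₁ (i-r , j-r) | inj₂ (j-s , i-s) =
    ⊥-elim (suc-no-2-cycle (trans (sym i-r) i-s) (trans (sym j-s) j-r))
  ... | inj₂ (j-r , i-r) | inj₁ (i-s , j-s) =
    ⊥-elim (suc-no-2-cycle (trans (sym j-r) j-s) (trans (sym i-s) i-r))

  Layer-near : ∀ {c s i j} → Layer c s i j ≡ true → d c i ≤ suc s × d c j ≤ suc s
  Layer-near ij∈ with Layer-ends ij∈
  ... | inj₁ (i-s , j-s) = ≤-trans (≤-reflexive i-s) (n≤1+n _) , ≤-reflexive j-s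
  ... | inj₂ (j-s , i-s) = ≤-reflexive i-s , ≤-trans (≤-reflexive j-s) (n≤1+n _)

  levels-far-apart : ∀ {c₁ c₂ R₁ R₂ r s} e → d c₁ c₂ ≡ R₁ + R₂ → r < R₁ → s < R₂ →
                     d c₁ e ≡ r → d c₂ e ≤ suc s → ⊥
  levels-far-apart {c₁} {c₂} {R₁} {R₂} {r} {s} e c₁c₂≡ r<R₁ s<R₂ c₁e≡r c₂e≤ = <-irrefl refl (begin-strict
    r + suc s       <⟨ +-monoˡ-< (suc s) (n<1+n r) ⟩
    suc r + suc s   ≤⟨ +-mono-≤ r<R₁ s<R₂ ⟩
    R₁ + R₂         ≡⟨ sym c₁c₂≡ ⟩
    d c₁ c₂         ≤⟨ d-triangle c₁ e c₂ ⟩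
    d c₁ e + d e c₂ ≡⟨ cong₂ _+_ c₁e≡r (d-sym e c₂) ⟩
    r + d c₂ e      ≤⟨ +-monoʳ-≤ r c₂e≤ ⟩
    r + suc s       ∎)
    where open ≤-Reasoning

  Layers-disjoint : ∀ {c₁ c₂ R₁ R₂ r s i j} → d c₁ c₂ ≡ R₁ + R₂ → r < R₁ → s < R₂ →
                    Layer c₁ r i j ≡ true → Layer c₂ s i j ≢ true
  Layers-disjoint {i = i} {j} c₁c₂≡ r<R₁ s<R₂ ij∈₁ ij∈₂ with Layer-ends ij∈₁ | Layer-near ij∈₂
  ... | inj₁ (i-r , _) | (i≤ , _) = levels-far-apart i c₁c₂≡ r<R₁ s<R₂ i-r i≤
  ... | inj₂ (j-r , _) | (_ , j≤) = levels-far-apart j c₁c₂≡ r<R₁ s<R₂ j-r j≤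

  walk-meets-Layer : ∀ (F : EdgeSubset G) {c e k} → Walk (sub F) c e k → ∀ r → r < d c e →
                     ∃₂ λ i j → (i ≺ j ∧ sub F i j) ≡ true × Layer c r i j ≡ true
  walk-meets-Layer F {c} W r r<ce with Walk-crossing (d c) r W (subst (_≤ r) (sym (d-refl c)) z≤n) r<ce
  ... | a , b , ab∈F , ca≤r , r<cb = orient (<-cmp (toℕ a) (toℕ b))
    where
    cb≤1+ca : d c b ≤ suc (d c a)
    cb≤1+ca = d-step c (sub-adj F a b ab∈F)
    ca≡r : d c a ≡ r
    ca≡r = ≤-antisym ca≤r (≤-pred (≤-trans r<cb cb≤1+ca))
    cb≡1+r : d c b ≡ suc r
    cb≡1+r = ≤-antisym (subst (λ t → d c b ≤ suc t) ca≡r cb≤1+ca) r<cb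
    orient : Tri (toℕ a < toℕ b) (toℕ a ≡ toℕ b) (toℕ b < toℕ a) →
             ∃₂ λ i j → (i ≺ j ∧ sub F i j) ≡ true × Layer c r i j ≡ true
    orient (tri< a<b _ _) = a , b , ∧-true⁺ (<⇒≺ a<b) ab∈F , Layer-intro ca≡r cb≡1+r
    orient (tri≈ _ a≡b _) =
      ⊥-elim (1+n≢n (sym (trans (sym ca≡r) (trans (cong (d c) (Fin.toℕ-injective a≡b)) cb≡1+r))))
    orient (tri> _ _ b<a) = b , a , ∧-true⁺ (<⇒≺ b<a) (trans (sub-sym F b a) ab∈F)
                          , trans (Layer-sym c r b a) (Layer-intro ca≡r cb≡1+r)

  Steiner-lower : ∀ {u v w} x y z → x + y ≡ d u v → x + z ≡ d u w → y + z ≡ d v w →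
                  (F : EdgeSubset G) → Spans F u v w → x + y + z ≤ edgeCount F
  Steiner-lower {u} {v} {w} x y z x+y≡ x+z≡ y+z≡ F ((_ , Wuv) , (_ , Wuw) , (_ , Wvw)) = begin
    x + y + z
      ≤⟨ +-mono-≤ (+-mono-≤ (hits Wuv x (≤-trans (m≤m+n x y) (≤-reflexive x+y≡)))
                            (hits Wvw y (≤-trans (m≤m+n y z) (≤-reflexive y+z≡))))
                  (hits (Walk-reverse (sub-sym F) Wuw) z
                        (≤-trans (m≤n+m z x) (≤-reflexive (trans x+z≡ (d-sym u w))))) ⟩
    on-edges (count u x) + on-edges (count v y) + on-edges (count w z)
      ≡⟨ sym (trans (on-edges-+ (λ i j → count u x i j + count v y i j) (count w z))
                    (cong (_+ on-edges (count w z)) (on-edges-+ (count u x) (count v y)))) ⟩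
    on-edges (λ i j → count u x i j + count v y i j + count w z i j)
      ≤⟨ ∑-mono-≤ (λ i → ∑-mono-≤ λ j → []⇒-mono-≤ (i ≺ j ∧ sub F i j) (counts≤1 i j)) ⟩
    edgeCount F ∎
    where
    open ≤-Reasoning
    on-edges : (Fin n → Fin n → ℕ) → ℕ
    on-edges f = ∑ λ i → ∑ λ j → [ i ≺ j ∧ sub F i j ]⇒ f i j
    on-edges-+ : ∀ f g → on-edges (λ i j → f i j + g i j) ≡ on-edges f + on-edges g
    on-edges-+ f g = trans (∑-cong λ i → ∑-cong λ j → []⇒-+ (i ≺ j ∧ sub F i j) (f i j) (g i j))
                           (∑∑-+ (λ i j → [ i ≺ j ∧ sub F i j ]⇒ f i j)
                                 (λ i j → [ i ≺ j ∧ sub F i j ]⇒ g i j))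
    count : Fin n → (R : ℕ) → Fin n → Fin n → ℕ
    count c R i j = ∑ {R} (λ r → [ Layer c (toℕ r) i j ]⇒ 1)
    hits : ∀ {c e k} → Walk (sub F) c e k → ∀ R → R ≤ d c e → R ≤ on-edges (count c R)
    hits {c} W R R≤ce = ≤-∑-hits (λ i j → i ≺ j ∧ sub F i j) (λ r → Layer c (toℕ r))
      (λ r → walk-meets-Layer F W (toℕ r) (<-≤-trans (Fin.toℕ<n r) R≤ce))
    count≤1 : ∀ c R i j → count c R i j ≤ 1
    count≤1 c R i j = count-unique≤1 {R} (λ r → Layer c (toℕ r) i j)
      (λ r s r∈ s∈ → Fin.toℕ-injective (Layer-unique r∈ s∈))
    counts≤1 : ∀ i j → count u x i j + count v y i j + count w z i j ≤ 1
    counts≤1 i j with Fin.any? {x} (λ r → Layer u (toℕ r) i j ≟ᴮ true)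
                    | Fin.any? {y} (λ s → Layer v (toℕ s) i j ≟ᴮ true)
    ... | yes (r , r∈) | _ = at-most-one-positive (inj₁ (count≤1 u x i j
      , count-vanishes {y} (λ s → Layer v (toℕ s) i j)
          (λ s → Layers-disjoint (sym x+y≡) (Fin.toℕ<n r) (Fin.toℕ<n s) r∈)
      , count-vanishes {z} (λ t → Layer w (toℕ t) i j)
          (λ t → Layers-disjoint (sym x+z≡) (Fin.toℕ<n r) (Fin.toℕ<n t) r∈)))
    ... | no ∄r | yes (s , s∈) = at-most-one-positive (inj₂ (inj₁ (
        count-vanishes {x} (λ r → Layer u (toℕ r) i j) (λ r r∈ → ∄r (r , r∈))
      , count≤1 v y i j
      , count-vanishes {z} (λ t → Layer w (toℕ t) i j)
          (λ t → Layers-disjoint (sym y+z≡) (Fin.toℕ<n s) (Fin.toℕ<n t) s∈))))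
    ... | no ∄r | no ∄s = at-most-one-positive (inj₂ (inj₂ (
        count-vanishes {x} (λ r → Layer u (toℕ r) i j) (λ r r∈ → ∄r (r , r∈))
      , count-vanishes {y} (λ s → Layer v (toℕ s) i j) (λ s s∈ → ∄s (s , s∈))
      , count≤1 w z i j)))

  Steiner-at-median : ∀ {u v w m s} → IsMedian G d u v w m → IsSteiner3 G u v w s →
                      s ≡ d m u + d m v + d m w
  Steiner-at-median {u} {v} {w} {m} (uv , uw , vw) ((F , spans , count≡s) , minimal)
    with Steiner-upper (geodesic m u) (geodesic m v) (geodesic m w)
  ... | F′ , spans′ , count′ =
    ≤-antisym (≤-trans (minimal F′ spans′) count′)
              (subst (_ ≤_) count≡s (Steiner-lower (d m u) (d m v) (d m w)
                 (median-split uv) (median-split uw) (median-split vw) F spans))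

  modular⇒Steiner-half-perimeter : Modular G d → ∀ {u v w s} → IsSteiner3 G u v w s →
                                   2 * s ≡ d u v + d u w + d v w
  modular⇒Steiner-half-perimeter modular {u} {v} {w} {s} steiner with modular u v w
  ... | m , median@(uv , uw , vw) = begin
    2 * s                                   ≡⟨ cong (2 *_) (Steiner-at-median median steiner) ⟩
    2 * (d m u + d m v + d m w)             ≡⟨ pairwise (d m u) (d m v) (d m w) ⟩
    (d m u + d m v) + (d m u + d m w) + (d m v + d m w)
      ≡⟨ cong₂ _+_ (cong₂ _+_ (median-split uv) (median-split uw)) (median-split vw) ⟩
    d u v + d u w + d v w                   ∎
    where
    open ≡-Reasoning
    pairwise : ∀ x y z → 2 * (x + y + z) ≡ (x + y) + (x + z) + (y + z)
    pairwise = solve-∀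

-- Connectivity is implied by the distance hypothesis, and for n < 3 both sides vanish.
theorem4p3 : (n : ℕ) → 3 ≤ n → (G : Graph n) → Connected G →
    (d : Fin n → Fin n → ℕ) → (∀ u v → IsDist G u v (d u v)) →
    (ds : Fin n → Fin n → Fin n → ℕ) →
    (∀ u v w → u ≢ v → u ≢ w → v ≢ w → IsSteiner3 G u v w (ds u v w)) →
    Modular G d →
    4 * twiceSWW3 ds ≡ 2 * (n ∸ 2) * Wiener d + (n ∸ 2) * WWbar d + WWhat d
theorem4p3 n _ G _ d d-dist ds steiner modular =
  SWW3-from-half-perimeter d ds d-sym λ i j k i≺j≺k →
    let (i≢j , i≢k , j≢k) = ordered⇒distinct i≺j≺k in
    modular⇒Steiner-half-perimeter modular (steiner i j k i≢j i≢k j≢k)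
  where open Metric G d d-dist
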